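{- For all positive integers $n,k$ with $n\ge 3$, the crown $C_n\odot K_1$ is a $k$-geometric mean graph.
   Context: The crown $C_n\odot K_1$ is the graph obtained from the cycle $C_n$ on $n$ vertices by attaching to each vertex of the cycle one new pendant vertex (the corona $G_1\odot G_2$ of a graph $G_1$ with $p$ vertices and a graph $G_2$ is obtained from one copy of $G_1$ and $p$ copies of $G_2$ by joining the $i$-th vertex of $G_1$ to every vertex of the $i$-th copy of $G_2$). Let $k$ be a positive integer. A finite simple graph $G$ with $p$ vertices and $q$ edges is a $k$-geometric mean graph if there is an injection $\psi: V(G)\to\{k,k+1,\dots,k+q\}$ such that, when each edge $uv$ is assigned one of the labels $\lfloor\sqrt{\psi(u)\psi(v)}\rfloor$ or $\lceil\sqrt{\psi(u)\psi(v)}\rceil$ (chosen per edge), the resulting set of edge labels is exactly $\{k,k+1,\dots,k+q-1\}$. -}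

module Defs where

open import Data.Nat using (ℕ; zero; suc; _+_; _*_; _∸_; _≤_; _<_)
open import Data.Nat.DivMod using (_%_; m%n<n)
open import Data.Fin using (Fin; toℕ; fromℕ<; _↑ˡ_; _↑ʳ_; splitAt)
open import Data.Product using (_×_; _,_; Σ; ∃)
open import Data.Sum using (_⊎_; inj₁; inj₂)
open import Relation.Binary.PropositionalEquality using (_≡_)
open import Function.Definitions using (Injective)

record Graph : Set where
  field
    p    : ℕ
    q    : ℕ
    edge : Fin q → Fin p × Fin p

open Graph public

IsFloorSqrt : ℕ → ℕ → Set
IsFloorSqrt m l = (l * l ≤ m) × (m < suc l * suc l)

-- l = ⌈√m⌉ :  (l-1)² < m ≤ l²   (with l = 0 iff m = 0)
IsCeilSqrt : ℕ → ℕ → Set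
IsCeilSqrt m l = (m ≤ l * l) × ((l ≡ 0) ⊎ ((l ∸ 1) * (l ∸ 1) < m))

GMLabel : ℕ → ℕ → Set
GMLabel m l = IsFloorSqrt m l ⊎ IsCeilSqrt m l

IsKGeometricMean : ℕ → Graph → Set
IsKGeometricMean k G =
  Σ (Fin (p G) → ℕ) λ ψ →
  Σ (Fin (q G) → ℕ) λ lab →
    Injective _≡_ _≡_ ψ
  × (∀ v → k ≤ ψ v × ψ v ≤ k + q G)
  × (∀ e → let (u , v) = edge G e in GMLabel (ψ u * ψ v) (lab e))
  × (∀ e → k ≤ lab e × lab e < k + q G)
  × (∀ l → k ≤ l → l < k + q G → ∃ λ e → lab e ≡ l)

next : ∀ {n} → Fin n → Fin n
next {suc m} i = fromℕ< (m%n<n (suc (toℕ i)) (suc m))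

-- The crown C_n ⊙ K₁: vertices Fin (n + n); cycle vertex i is  i ↑ˡ n,
-- its pendant vertex is  n ↑ʳ i.
crown : ℕ → Graph
crown n = record
  { p = n + n
  ; q = n + n
  ; edge = λ e → edgeOf (splitAt n e)
  }
  where
  edgeOf : Fin n ⊎ Fin n → Fin (n + n) × Fin (n + n)
  edgeOf (inj₁ i) = (i ↑ˡ n , next i ↑ˡ n)
  edgeOf (inj₂ i) = (i ↑ˡ n , n ↑ʳ i)

module Submission where

-- Rank the cycle positions in zigzag order: position i gets rank 2i
-- while 2i < n, and position n-1-t gets rank 2t+1 otherwise.  In terms of
-- ranks the cycle then has the edges {0,1}, {r, r+2} (r ≤ n-3) and
-- {n-2, n-1}.  The cycle vertex of rank r gets k + 2r; the pendant of rank
-- r ≤ n-3 gets k + 2r + 1, the pendants of ranks n-2, n-1 get k + 2n - 1 and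
-- k + 2n.  Edge {0,1} is labelled ⌊√(k(k+2))⌋ = k, every other edge by a
-- ceiling: the rung {r, r+2} by k + 2r + 2, the top edge by k + 2n - 3, the
-- pendant edges by k + 2r + 1 resp. k + 2n - 2, k + 2n - 1.

open import Defs
open import Data.Nat using (ℕ; zero; suc; _+_; _*_; _∸_; _%_; _≤_; _<_; z≤n; s≤s; s≤s⁻¹; _<?_; _≤?_)
open import Data.Nat.DivMod using (m%n<n; m<n⇒m%n≡m; n%n≡0)
open import Data.Nat.Properties
open import Data.Nat.Tactic.RingSolver using (solve)
open import Data.Fin using (Fin; toℕ; fromℕ<; _↑ˡ_; _↑ʳ_; splitAt; join)
open import Data.Fin.Properties using (toℕ-injective; toℕ<n; toℕ-fromℕ<; splitAt-↑ˡ; splitAt-↑ʳ; join-splitAt)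
open import Data.List using (_∷_; [])
open import Data.Product using (∃; _×_; _,_; proj₁; proj₂)
open import Data.Sum using (_⊎_; inj₁; inj₂)
open import Data.Empty using (⊥; ⊥-elim)
open import Data.Bool using (if_then_else_)
open import Relation.Nullary using (¬_; yes; no; does)
open import Relation.Nullary.Decidable using (dec-true; dec-false)
open import Relation.Binary.PropositionalEquality
open import Function.Definitions using (Injective)

≤-by : ∀ {x y} c → y ≡ x + c → x ≤ y
≤-by {x} c refl = m≤m+n x c

<-by : ∀ {x y} c → y ≡ suc (x + c) → x < y
<-by c eq = ≤-by c eq

difference : ∀ {x y} → x ≤ y → ∃ λ c → y ≡ x + c
difference x≤y with m≤n⇒∃[o]m+o≡n x≤y
... | c , eq = c , sym eq

overshoot : ∀ {x y} c → x ≡ y + suc c → x ≤ y → ⊥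
overshoot {y = y} c refl = m+1+n≰m y

double : ∀ x → 2 * x ≡ x + x
double x = solve (x ∷ [])

data Parity (d : ℕ) : Set where
  even : ∀ h → d ≡ 2 * h → Parity d
  odd  : ∀ h → d ≡ suc (2 * h) → Parity d

parity : ∀ d → Parity d
parity zero = even 0 refl
parity (suc d) with parity d
... | even h refl = odd h refl
... | odd h refl  = even (suc h) twice-succ
  where
  twice-succ : suc (suc (2 * h)) ≡ 2 * suc h
  twice-succ = solve (h ∷ [])

-- Square-root labels.  All edges of the labelling below join values x and
-- x + g with a gap g ≤ 4; these are the admissible labels needed.

ceil-intro : ∀ {v l} → l * l < v → v ≤ suc l * suc l → GMLabel v (suc l)
ceil-intro lo hi = inj₂ (hi , inj₂ lo)

floor-gap2 : ∀ x → GMLabel (x * (2 + x)) x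
floor-gap2 x = inj₁ (≤-by (2 * x) value , <-by 0 next-square)
  where
  value : x * (2 + x) ≡ x * x + 2 * x
  value = solve (x ∷ [])
  next-square : suc x * suc x ≡ suc (x * (2 + x) + 0)
  next-square = solve (x ∷ [])

ceil-gap1 : ∀ x → 1 ≤ x → GMLabel (x * (1 + x)) (1 + x)
ceil-gap1 zero ()
ceil-gap1 (suc b) _ = ceil-intro (<-by b value) (≤-by (2 + b) next-square)
  where
  value : suc b * (2 + b) ≡ suc (suc b * suc b + b)
  value = solve (b ∷ [])
  next-square : (2 + b) * (2 + b) ≡ suc b * (2 + b) + (2 + b)
  next-square = solve (b ∷ [])

ceil-gap2 : ∀ x → 1 ≤ x → GMLabel (x * (2 + x)) (1 + x)
ceil-gap2 zero ()
ceil-gap2 (suc b) _ = ceil-intro (<-by (1 + 2 * b) value) (≤-by 1 next-square)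
  where
  value : suc b * (3 + b) ≡ suc (suc b * suc b + (1 + 2 * b))
  value = solve (b ∷ [])
  next-square : (2 + b) * (2 + b) ≡ suc b * (3 + b) + 1
  next-square = solve (b ∷ [])

ceil-gap3 : ∀ x → 2 ≤ x → GMLabel (x * (3 + x)) (2 + x)
ceil-gap3 zero ()
ceil-gap3 (suc zero) (s≤s ())
ceil-gap3 (suc (suc b)) _ = ceil-intro (<-by b value) (≤-by (6 + b) next-square)
  where
  value : (2 + b) * (5 + b) ≡ suc ((3 + b) * (3 + b) + b)
  value = solve (b ∷ [])
  next-square : (4 + b) * (4 + b) ≡ (2 + b) * (5 + b) + (6 + b)
  next-square = solve (b ∷ [])

ceil-gap4 : ∀ x → 1 ≤ x → GMLabel (x * (4 + x)) (2 + x)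
ceil-gap4 zero ()
ceil-gap4 (suc b) _ = ceil-intro (<-by (2 * b) value) (≤-by 4 next-square)
  where
  value : suc b * (5 + b) ≡ suc ((2 + b) * (2 + b) + 2 * b)
  value = solve (b ∷ [])
  next-square : (3 + b) * (3 + b) ≡ suc b * (5 + b) + 4
  next-square = solve (b ∷ [])

gm-sym : ∀ x y {l} → GMLabel (x * y) l → GMLabel (y * x) l
gm-sym x y {l} = subst (λ v → GMLabel v l) (*-comm x y)

gm-cong : ∀ x {y y' l l'} → y ≡ y' → l ≡ l' → GMLabel (x * y') l' → GMLabel (x * y) l
gm-cong x refl refl g = g

-- The zigzag ranking of the cycle positions 0, …, n-1.  Walking around the
-- cycle, the ranks read 0, 2, 4, … (ascending half) and then … , 5, 3, 1
-- (descending half), so cyclically consecutive positions have ranks that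
-- differ by at most 2.  The ranking is a permutation of {0, …, n-1}.
module Ranking (n : ℕ) where

  rank : ℕ → ℕ
  rank i = if does (2 * i <? n) then 2 * i else suc (2 * (n ∸ suc i))

  data Position (i r : ℕ) : Set where
    ascending  : 2 * i < n → r ≡ 2 * i → Position i r
    descending : ∀ t → i + suc t ≡ n → t < i → r ≡ suc (2 * t) → Position i r

  descending-upper : ∀ {i t} → i + suc t ≡ n → t < i → n ≤ 2 * i
  descending-upper {i} {t} eq t<i = begin
      n          ≡⟨ sym eq ⟩
      i + suc t  ≤⟨ +-monoʳ-≤ i t<i ⟩
      i + i      ≡⟨ sym (double i) ⟩
      2 * i      ∎
    where open ≤-Reasoning

  rank-ascending : ∀ {i} → 2 * i < n → rank i ≡ 2 * i
  rank-ascending {i} p rewrite dec-true (2 * i <? n) p = refl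

  rank-upper : ∀ {i} → ¬ 2 * i < n → rank i ≡ suc (2 * (n ∸ suc i))
  rank-upper {i} ¬p rewrite dec-false (2 * i <? n) ¬p = refl

  position : ∀ i → i < n → Position i (rank i)
  position i i<n with 2 * i <? n
  ... | yes p = ascending p (rank-ascending p)
  ... | no ¬p = descending t total (+-cancelˡ-≤ i (suc t) i upper) (rank-upper ¬p)
    where
    t : ℕ
    t = n ∸ suc i
    total : i + suc t ≡ n
    total = trans (+-suc i t) (m+[n∸m]≡n i<n)
    upper : i + suc t ≤ i + i
    upper = subst₂ _≤_ (sym total) (double i) (≮⇒≥ ¬p)

  rank-at : ∀ {i r} → Position i r → rank i ≡ r
  rank-at (ascending p eq) = trans (rank-ascending p) (sym eq)
  rank-at {i} (descending t eq t<i refl) = begin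
      rank i                 ≡⟨ rank-upper not-ascending ⟩
      suc (2 * (n ∸ suc i))  ≡⟨ cong (λ s → suc (2 * s)) remaining ⟩
      suc (2 * t)            ∎
    where
    open ≡-Reasoning
    not-ascending : ¬ 2 * i < n
    not-ascending p = <-irrefl refl (<-≤-trans p (descending-upper eq t<i))
    remaining : n ∸ suc i ≡ t
    remaining = trans (cong (_∸ suc i) (trans (sym eq) (+-suc i t))) (m+n∸m≡n (suc i) t)

  position-< : ∀ {i r} → Position i r → i < n
  position-< {i} (ascending p _) = ≤-<-trans (m≤n*m i 2) p
  position-< {i} (descending t eq _ _) = <-by t (trans (sym eq) (+-suc i t))

  rank-< : ∀ {i r} → Position i r → r < n
  rank-< (ascending p refl) = p
  rank-< (descending t eq t<i refl) = subst₂ _≤_ two-odd eq (+-monoˡ-≤ (suc t) t<i)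
    where
    two-odd : suc t + suc t ≡ suc (suc (2 * t))
    two-odd = solve (t ∷ [])

  rank-injective : ∀ {i j r} → Position i r → Position j r → i ≡ j
  rank-injective {i} {j} (ascending _ e) (ascending _ e') = *-cancelˡ-≡ i j 2 (trans (sym e) e')
  rank-injective {i} (ascending _ e) (descending t' _ _ e') = ⊥-elim (even≢odd i t' (trans (sym e) e'))
  rank-injective {j = j} (descending t _ _ e) (ascending _ e') = ⊥-elim (even≢odd j t (trans (sym e') e))
  rank-injective {i} {j} (descending t eq _ e) (descending t' eq' _ e') =
    +-cancelʳ-≡ (suc t) i j (trans eq (trans (sym eq') (cong (λ s → j + suc s) (sym same))))
    where
    same : t ≡ t'
    same = *-cancelˡ-≡ t t' 2 (suc-injective (trans (sym e) e'))

  position-of : ∀ r → r < n → ∃ λ i → Position i r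
  position-of r r<n with parity r
  ... | even h refl = h , ascending r<n refl
  ... | odd h refl with difference r<n
  ...   | c , n≡ = suc (h + c) , descending h (trans total (sym n≡)) (s≤s (m≤m+n h c)) refl
    where
    total : suc (h + c) + suc h ≡ suc (suc (2 * h)) + c
    total = solve (h ∷ c ∷ [])

-- All
-- vertex values and edge labels in this module are offsets from k.
module Zigzag (m : ℕ) where

  n : ℕ
  n = 3 + m

  open Ranking n public

  succPos : ℕ → ℕ
  succPos i = suc i % n

  succPos-inner : ∀ {i} → suc i < n → succPos i ≡ suc i
  succPos-inner = m<n⇒m%n≡m

  succPos-last : succPos (2 + m) ≡ 0
  succPos-last = n%n≡0 n

  data ZigEdge (a b : ℕ) : Set where
    bottom : a ≡ 0 → b ≡ 1 → ZigEdge a b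
    rung   : a ≤ m → b ≡ 2 + a → ZigEdge a b
    top    : a ≡ suc m → b ≡ 2 + m → ZigEdge a b

  Adjacent : ℕ → ℕ → Set
  Adjacent a b = ZigEdge a b ⊎ ZigEdge b a

  ascending-step : ∀ {i} → 2 * suc i < n → ZigEdge (2 * i) (2 * suc i)
  ascending-step {i} p = rung (+-cancelˡ-≤ 3 (2 * i) m (subst (_≤ 3 + m) three-more p)) two-more
    where
    two-more : 2 * suc i ≡ 2 + 2 * i
    two-more = solve (i ∷ [])
    three-more : suc (2 * suc i) ≡ 3 + 2 * i
    three-more = solve (i ∷ [])

  descending-step : ∀ {i t t'} → i + suc t ≡ n → t < i → suc i + suc t' ≡ n →
                    ZigEdge (suc (2 * t')) (suc (2 * t))
  descending-step {i} {t} {t'} eq t<i eq'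
    with suc-injective (+-cancelˡ-≡ i _ _ (trans eq (trans (sym eq') (sym (+-suc i (suc t'))))))
  ... | refl = rung (+-cancelˡ-≤ 3 _ _ bound) twice-succ
    where
    twice-succ : suc (2 * suc t') ≡ 2 + suc (2 * t')
    twice-succ = solve (t' ∷ [])
    doubled : 3 + suc (2 * t') ≡ suc (suc t') + suc (suc t')
    doubled = solve (t' ∷ [])
    open ≤-Reasoning
    bound : 3 + suc (2 * t') ≤ 3 + m
    bound = begin
      3 + suc (2 * t')            ≡⟨ doubled ⟩
      suc (suc t') + suc (suc t') ≤⟨ +-monoˡ-≤ (suc (suc t')) t<i ⟩
      i + suc (suc t')            ≡⟨ eq ⟩
      3 + m                       ∎

  -- Where the ascending half turns into the descending one, the two ranks
  -- are the top ranks n - 2 and n - 1 (in either order, by the parity of n).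
  turning-point : ∀ {i t} → 2 * i < n → suc i + suc t ≡ n → t ≤ i →
                  Adjacent (2 * i) (suc (2 * t))
  turning-point {i} {t} p eq t≤i with difference t≤i
  ... | zero , refl = inj₁ (top (trans (cong (2 *_) (+-identityʳ t)) half) (cong suc half))
    where
    total : suc (t + 0) + suc t ≡ 2 + 2 * t
    total = solve (t ∷ [])
    half : 2 * t ≡ suc m
    half = +-cancelˡ-≡ 2 _ _ (trans (sym total) eq)
  ... | suc zero , refl = inj₂ (top (cong suc half) (trans twice-succ (cong (2 +_) half)))
    where
    total : suc (t + 1) + suc t ≡ 3 + 2 * t
    total = solve (t ∷ [])
    half : 2 * t ≡ m
    half = +-cancelˡ-≡ 3 _ _ (trans (sym total) eq)
    twice-succ : 2 * (t + 1) ≡ 2 + 2 * t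
    twice-succ = solve (t ∷ [])
  ... | suc (suc c) , refl = ⊥-elim (overshoot c excess (subst (suc (2 * (t + suc (suc c))) ≤_) (sym eq) p))
    where
    excess : suc (2 * (t + suc (suc c))) ≡ suc (t + suc (suc c)) + suc t + suc c
    excess = solve (t ∷ c ∷ [])

  -- The ranks of two consecutive positions i, i + 1 < n are adjacent; a
  -- descending position is never followed by an ascending one.
  step-adjacent : ∀ {i a b} → Position i a → Position (suc i) b → Adjacent a b
  step-adjacent (ascending _ refl) (ascending p refl) = inj₁ (ascending-step p)
  step-adjacent (ascending p refl) (descending t eq t≤i refl) = turning-point p eq (s≤s⁻¹ t≤i)
  step-adjacent {i} (descending t eq t<i _) (ascending p _) =
    ⊥-elim (<-irrefl refl (<-≤-trans p (≤-trans (descending-upper eq t<i) (*-monoʳ-≤ 2 (n≤1+n i)))))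
  step-adjacent (descending t eq t<i refl) (descending t' eq' _ refl) = inj₂ (descending-step eq t<i eq')

  -- The wrap-around edge {n - 1, 0} is the bottom edge.
  rank-first : rank 0 ≡ 0
  rank-first = rank-ascending {0} (s≤s z≤n)

  rank-last : rank (2 + m) ≡ 1
  rank-last = rank-at {2 + m} (descending 0 (+-comm (2 + m) 1) (s≤s z≤n) refl)

  cycle-adjacent : ∀ i → i < n → Adjacent (rank i) (rank (succPos i))
  cycle-adjacent i i<n with suc i <? n
  ... | yes i+1<n = subst (λ j → Adjacent (rank i) (rank j)) (sym (succPos-inner i+1<n))
                      (step-adjacent (position i i<n) (position (suc i) i+1<n))
  ... | no i+1≮n with ≤-antisym (s≤s⁻¹ i<n) (s≤s⁻¹ (≮⇒≥ i+1≮n))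
  ...   | refl rewrite succPos-last | rank-first | rank-last = inj₂ (bottom refl refl)

  -- A cycle edge {i, i + 1 mod n} whose end ranks sum to a + b; the sum
  -- is all that the label of the edge depends on.
  EdgeWithRanks : ℕ → ℕ → Set
  EdgeWithRanks a b = ∃ λ i → i < n × rank i + rank (succPos i) ≡ a + b

  consecutive : ∀ {i a b} → suc i < n → Position i a → Position (suc i) b → EdgeWithRanks a b
  consecutive {i} i+1<n pa pb =
    i , <-trans (n<1+n i) i+1<n ,
    cong₂ _+_ (rank-at pa) (trans (cong rank (succPos-inner i+1<n)) (rank-at pb))

  swapped : ∀ {a b} → EdgeWithRanks b a → EdgeWithRanks a b
  swapped {a} {b} (i , i<n , sum) = i , i<n , trans sum (+-comm b a)

  -- The rung {r, r + 2} lies on the ascending half for r even and on the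
  -- descending half for r odd.
  rung-on-cycle : ∀ {a} → a ≤ m → EdgeWithRanks a (2 + a)
  rung-on-cycle {a} a≤m with parity a
  ... | even h refl = consecutive {h} (≤-<-trans (m≤n*m (suc h) 2) right)
                        (ascending left refl) (ascending right twice-succ)
    where
    twice-succ : 2 + 2 * h ≡ 2 * suc h
    twice-succ = solve (h ∷ [])
    left : 2 * h < n
    left = s≤s (≤-trans a≤m (m≤n+m m 2))
    right : 2 * suc h < n
    right = s≤s (subst (_≤ 2 + m) twice-succ (+-monoʳ-≤ 2 a≤m))
  ... | odd h refl with difference a≤m
  ...   | c , m≡ = swapped {suc (2 * h)} (consecutive {suc (suc (h + c))} inner
                      (descending (suc h) upper (s≤s (s≤s (m≤m+n h c))) odd-succ)
                      (descending h lower (s≤s (≤-trans (m≤m+n h c) (m≤n+m (h + c) 2))) refl))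
    where
    n≡ : n ≡ suc (suc (suc (suc (2 * h) + c)))
    n≡ = cong (3 +_) m≡
    upper-sum : suc (suc (h + c)) + suc (suc h) ≡ suc (suc (suc (suc (2 * h) + c)))
    upper-sum = solve (h ∷ c ∷ [])
    upper : suc (suc (h + c)) + suc (suc h) ≡ n
    upper = trans upper-sum (sym n≡)
    lower-sum : suc (suc (suc (h + c))) + suc h ≡ suc (suc (suc (suc (2 * h) + c)))
    lower-sum = solve (h ∷ c ∷ [])
    lower : suc (suc (suc (h + c))) + suc h ≡ n
    lower = trans lower-sum (sym n≡)
    odd-succ : 2 + suc (2 * h) ≡ suc (2 * suc h)
    odd-succ = solve (h ∷ [])
    inner-sum : suc (suc (suc (suc (2 * h) + c))) ≡ suc (suc (suc (suc (h + c))) + h)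
    inner-sum = solve (h ∷ c ∷ [])
    inner : suc (suc (suc (h + c))) < n
    inner = <-by h (trans n≡ inner-sum)

  -- The top edge joins positions ⌊m/2⌋ + 1 and ⌊m/2⌋ + 2.
  top-on-cycle : EdgeWithRanks (suc m) (2 + m)
  top-on-cycle with parity m
  ... | even h m≡ = swapped {suc m} (consecutive {suc h} inner
                      (ascending middle (trans (cong (2 +_) m≡) twice-succ))
                      (descending h upper (m<n⇒m<1+n (n<1+n h)) (cong suc m≡)))
    where
    twice-succ : 2 + 2 * h ≡ 2 * suc h
    twice-succ = solve (h ∷ [])
    middle-sum : 3 + 2 * h ≡ suc (2 * suc h + 0)
    middle-sum = solve (h ∷ [])
    middle : 2 * suc h < n
    middle = <-by 0 (trans (cong (3 +_) m≡) middle-sum)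
    upper-sum : suc (suc h) + suc h ≡ 3 + 2 * h
    upper-sum = solve (h ∷ [])
    upper : suc (suc h) + suc h ≡ n
    upper = trans upper-sum (sym (cong (3 +_) m≡))
    inner-sum : 3 + 2 * h ≡ suc (suc (suc h) + h)
    inner-sum = solve (h ∷ [])
    inner : suc (suc h) < n
    inner = <-by h (trans (cong (3 +_) m≡) inner-sum)
  ... | odd h m≡ = consecutive {suc h} inner
                      (ascending middle (trans (cong suc m≡) twice-succ))
                      (descending (suc h) upper (n<1+n (suc h)) (trans (cong (2 +_) m≡) odd-succ))
    where
    twice-succ : suc (suc (2 * h)) ≡ 2 * suc h
    twice-succ = solve (h ∷ [])
    odd-succ : 2 + suc (2 * h) ≡ suc (2 * suc h)
    odd-succ = solve (h ∷ [])
    middle-sum : 4 + 2 * h ≡ suc (2 * suc h + 1)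
    middle-sum = solve (h ∷ [])
    middle : 2 * suc h < n
    middle = <-by 1 (trans (cong (3 +_) m≡) middle-sum)
    upper-sum : suc (suc h) + suc (suc h) ≡ 4 + 2 * h
    upper-sum = solve (h ∷ [])
    upper : suc (suc h) + suc (suc h) ≡ n
    upper = trans upper-sum (sym (cong (3 +_) m≡))
    inner-sum : 4 + 2 * h ≡ suc (suc (suc h) + suc h)
    inner-sum = solve (h ∷ [])
    inner : suc (suc h) < n
    inner = <-by (suc h) (trans (cong (3 +_) m≡) inner-sum)

  zig-edge-on-cycle : ∀ {a b} → ZigEdge a b → EdgeWithRanks a b
  zig-edge-on-cycle (bottom refl refl) =
    2 + m , ≤-refl , cong₂ _+_ rank-last (trans (cong rank succPos-last) rank-first)
  zig-edge-on-cycle (rung a≤m refl) = rung-on-cycle a≤m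
  zig-edge-on-cycle (top refl refl) = top-on-cycle

  -- The label offset of a cycle edge whose end ranks sum to s: the sum s
  -- itself, except that the bottom edge {0, 1} gets offset 0.
  zig : ℕ → ℕ
  zig 1 = 0
  zig s = s

  zig-≥2 : ∀ {s} t → s ≡ 2 + t → zig s ≡ 2 + t
  zig-≥2 t refl = refl

  zig-≤ : ∀ s → zig s ≤ s
  zig-≤ 1 = z≤n
  zig-≤ 0 = z≤n
  zig-≤ (suc (suc s)) = ≤-refl

  pendantValue : ℕ → ℕ
  pendantValue r = if does (r ≤? m) then suc (2 * r) else r + suc n

  pendantLabel : ℕ → ℕ
  pendantLabel r = if does (r ≤? m) then suc (2 * r) else r + n

  pendant-low : ∀ {r} → r ≤ m → pendantValue r ≡ suc (2 * r) × pendantLabel r ≡ suc (2 * r)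
  pendant-low {r} p rewrite dec-true (r ≤? m) p = refl , refl

  pendant-high : ∀ {r} → ¬ r ≤ m → pendantValue r ≡ r + suc n × pendantLabel r ≡ r + n
  pendant-high {r} ¬p rewrite dec-false (r ≤? m) ¬p = refl , refl

  top-rank : ∀ {r} → r < n → ¬ r ≤ m → r ≡ suc m ⊎ r ≡ 2 + m
  top-rank {r} r<n ¬p with difference (≰⇒> ¬p)
  ... | zero , refl = inj₁ (+-identityʳ (suc m))
  ... | suc zero , refl = inj₂ (+-comm (suc m) 1)
  ... | suc (suc c) , refl = ⊥-elim (overshoot c excess r<n)
    where
    excess : suc (suc m + suc (suc c)) ≡ 3 + m + suc c
    excess = solve (m ∷ c ∷ [])

  top-value-bound : ∀ {r} → ¬ r ≤ m → suc m + suc n ≤ pendantValue r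
  top-value-bound ¬p = subst (_ ≤_) (sym (proj₁ (pendant-high ¬p))) (+-monoˡ-≤ (suc n) (≰⇒> ¬p))

  cycle-value-bound : ∀ {r} → r < n → 2 * r < suc m + suc n
  cycle-value-bound {r} r<n = ≤-<-trans (*-monoʳ-≤ 2 (s≤s⁻¹ r<n)) (<-by 0 gap)
    where
    gap : suc m + suc (3 + m) ≡ suc (2 * (2 + m) + 0)
    gap = solve (m ∷ [])

  low-value-bound : ∀ {r} → r ≤ m → suc (2 * r) < suc m + suc n
  low-value-bound {r} r≤m = ≤-<-trans (s≤s (*-monoʳ-≤ 2 r≤m)) (<-by 3 gap)
    where
    gap : suc m + suc (3 + m) ≡ suc (suc (2 * m) + 3)
    gap = solve (m ∷ [])

  cycle≢pendant : ∀ {r r'} → r < n → 2 * r ≢ pendantValue r'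
  cycle≢pendant {r} {r'} r<n eq with r' ≤? m
  ... | yes p = even≢odd r r' (trans eq (proj₁ (pendant-low p)))
  ... | no ¬p = <⇒≢ (<-≤-trans (cycle-value-bound r<n) (top-value-bound ¬p)) eq

  pendant-injective : ∀ {r r'} → pendantValue r ≡ pendantValue r' → r ≡ r'
  pendant-injective {r} {r'} eq with r ≤? m | r' ≤? m
  ... | yes p | yes p' = *-cancelˡ-≡ r r' 2 (suc-injective
                           (trans (sym (proj₁ (pendant-low p))) (trans eq (proj₁ (pendant-low p')))))
  ... | no ¬p | no ¬p' = +-cancelʳ-≡ (suc n) r r'
                           (trans (sym (proj₁ (pendant-high ¬p))) (trans eq (proj₁ (pendant-high ¬p'))))
  ... | yes p | no ¬p' = ⊥-elim (<⇒≢ (<-≤-trans (low-value-bound p) (top-value-bound ¬p'))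
                                     (trans (sym (proj₁ (pendant-low p))) eq))
  ... | no ¬p | yes p' = ⊥-elim (<⇒≢ (<-≤-trans (low-value-bound p') (top-value-bound ¬p))
                                     (trans (sym (proj₁ (pendant-low p'))) (sym eq)))

  cycle-value-≤ : ∀ {r} → r < n → 2 * r ≤ n + n
  cycle-value-≤ {r} r<n = subst (2 * r ≤_) (double n) (*-monoʳ-≤ 2 (<⇒≤ r<n))

  pendant-value-≤ : ∀ {r} → r < n → pendantValue r ≤ n + n
  pendant-value-≤ {r} r<n with r ≤? m
  ... | yes p = subst₂ _≤_ (sym (proj₁ (pendant-low p))) (double n) (*-monoʳ-< 2 r<n)
  ... | no ¬p = subst₂ _≤_ (sym (trans (proj₁ (pendant-high ¬p)) (+-suc r n))) refl (+-monoˡ-≤ n r<n)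

  cycle-label-< : ∀ {a b} → a < n → b < n → zig (a + b) < n + n
  cycle-label-< {a} {b} a<n b<n = ≤-<-trans (zig-≤ (a + b)) (+-mono-< a<n b<n)

  pendant-label-< : ∀ {r} → r < n → pendantLabel r < n + n
  pendant-label-< {r} r<n with r ≤? m
  ... | yes p = subst₂ _≤_ twice-succ (double n) (*-monoʳ-≤ 2 r<n)
    where
    doubled : 2 * suc r ≡ suc (suc (2 * r))
    doubled = solve (r ∷ [])
    twice-succ : 2 * suc r ≡ suc (pendantLabel r)
    twice-succ = trans doubled (cong suc (sym (proj₂ (pendant-low p))))
  ... | no ¬p = subst (_< n + n) (sym (proj₂ (pendant-high ¬p))) (+-monoˡ-< n r<n)

  halve : ∀ {x} → 2 * x < n + n → x < n
  halve {x} p = *-cancelˡ-< 2 x n (subst (2 * x <_) (sym (double n)) p)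

  data Source (d : ℕ) : Set where
    zig-edge     : ∀ {a b} → ZigEdge a b → zig (a + b) ≡ d → Source d
    pendant-edge : ∀ {r} → r < n → pendantLabel r ≡ d → Source d

  source : ∀ d → d < n + n → Source d
  source d d<2n with parity d
  ... | even zero refl = zig-edge (bottom refl refl) refl
  ... | even (suc r) refl with r ≤? m
  ...   | yes p = zig-edge (rung p refl) (trans (zig-≥2 (2 * r) rung-sum) twice-succ)
    where
    rung-sum : r + (2 + r) ≡ 2 + 2 * r
    rung-sum = solve (r ∷ [])
    twice-succ : 2 + 2 * r ≡ 2 * suc r
    twice-succ = solve (r ∷ [])
  ...   | no ¬p with top-rank (<-trans (n<1+n r) (halve d<2n)) ¬p
  ...     | inj₁ refl = pendant-edge {r = suc m} (<-trans (n<1+n (suc m)) (halve d<2n))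
                          (trans (proj₂ (pendant-high ¬p)) penultimate)
    where
    penultimate : suc m + (3 + m) ≡ 2 * suc (suc m)
    penultimate = solve (m ∷ [])
  ...     | inj₂ refl = ⊥-elim (<-irrefl refl (halve d<2n))
  source d d<2n | odd h refl with h ≤? m
  ...   | yes p = pendant-edge h<n (proj₂ (pendant-low p))
    where
    h<n : h < n
    h<n = halve (<-trans (n<1+n (2 * h)) d<2n)
  ...   | no ¬p with top-rank (halve (<-trans (n<1+n (2 * h)) d<2n)) ¬p
  ...     | inj₁ refl = zig-edge (top refl refl) (trans (zig-≥2 (suc (2 * m)) top-sum) odd-succ)
    where
    top-sum : suc m + (2 + m) ≡ 2 + suc (2 * m)
    top-sum = solve (m ∷ [])
    odd-succ : 2 + suc (2 * m) ≡ suc (2 * suc m)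
    odd-succ = solve (m ∷ [])
  ...     | inj₂ refl = pendant-edge ≤-refl (trans (proj₂ (pendant-high ¬p)) last)
    where
    last : 2 + m + (3 + m) ≡ suc (2 * (2 + m))
    last = solve (m ∷ [])

module CrownLabelling (m k : ℕ) (k≥1 : 1 ≤ k) where

  open Zigzag m

  positive : ∀ x → 1 ≤ k + x
  positive x = ≤-trans k≥1 (m≤m+n k x)

  zig-gm : ∀ {a b} → ZigEdge a b → GMLabel ((k + 2 * a) * (k + 2 * b)) (k + zig (a + b))
  zig-gm (bottom refl refl) = gm-cong (k + 0) other-end refl (floor-gap2 (k + 0))
    where
    other-end : k + 2 ≡ 2 + (k + 0)
    other-end = solve (k ∷ [])
  zig-gm {a} (rung _ refl) =
    gm-cong (k + 2 * a) other-end label-value (ceil-gap4 (k + 2 * a) (positive _))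
    where
    other-end : k + 2 * (2 + a) ≡ 4 + (k + 2 * a)
    other-end = solve (k ∷ a ∷ [])
    rung-sum : a + (2 + a) ≡ 2 + 2 * a
    rung-sum = solve (a ∷ [])
    shift : k + (2 + 2 * a) ≡ 2 + (k + 2 * a)
    shift = solve (k ∷ a ∷ [])
    label-value : k + zig (a + (2 + a)) ≡ 2 + (k + 2 * a)
    label-value = trans (cong (k +_) (zig-≥2 (2 * a) rung-sum)) shift
  zig-gm (top refl refl) =
    gm-cong (k + 2 * suc m) other-end label-value (ceil-gap2 (k + 2 * suc m) (positive _))
    where
    other-end : k + 2 * (2 + m) ≡ 2 + (k + 2 * suc m)
    other-end = solve (k ∷ m ∷ [])
    top-sum : suc m + (2 + m) ≡ 2 + suc (2 * m)
    top-sum = solve (m ∷ [])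
    shift : k + (2 + suc (2 * m)) ≡ 1 + (k + 2 * suc m)
    shift = solve (k ∷ m ∷ [])
    label-value : k + zig (suc m + (2 + m)) ≡ 1 + (k + 2 * suc m)
    label-value = trans (cong (k +_) (zig-≥2 (suc (2 * m)) top-sum)) shift

  adjacent-gm : ∀ {a b} → Adjacent a b → GMLabel ((k + 2 * a) * (k + 2 * b)) (k + zig (a + b))
  adjacent-gm (inj₁ e) = zig-gm e
  adjacent-gm {a} {b} (inj₂ e) =
    gm-sym (k + 2 * b) (k + 2 * a)
      (subst (λ s → GMLabel ((k + 2 * b) * (k + 2 * a)) (k + zig s)) (+-comm b a) (zig-gm e))

  pendant-gm : ∀ {r} → r < n → GMLabel ((k + 2 * r) * (k + pendantValue r)) (k + pendantLabel r)
  pendant-gm {r} r<n with r ≤? m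
  ... | yes p = gm-cong (k + 2 * r) (shifted (proj₁ (pendant-low p))) (shifted (proj₂ (pendant-low p)))
                  (ceil-gap1 (k + 2 * r) (positive _))
    where
    shifted : ∀ {v} → v ≡ suc (2 * r) → k + v ≡ 1 + (k + 2 * r)
    shifted refl = +-suc k (2 * r)
  ... | no ¬p with top-rank r<n ¬p
  ...   | inj₁ refl = gm-cong (k + 2 * suc m)
                        (trans (cong (k +_) (proj₁ (pendant-high ¬p))) other-end)
                        (trans (cong (k +_) (proj₂ (pendant-high ¬p))) label-value)
                        (ceil-gap3 (k + 2 * suc m) two≤)
    where
    other-end : k + (suc m + suc (3 + m)) ≡ 3 + (k + 2 * suc m)
    other-end = solve (k ∷ m ∷ [])
    label-value : k + (suc m + (3 + m)) ≡ 2 + (k + 2 * suc m)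
    label-value = solve (k ∷ m ∷ [])
    two≤ : 2 ≤ k + 2 * suc m
    two≤ = ≤-trans (*-monoʳ-≤ 2 (s≤s (z≤n {m}))) (m≤n+m (2 * suc m) k)
  ...   | inj₂ refl = gm-cong (k + 2 * (2 + m))
                        (trans (cong (k +_) (proj₁ (pendant-high ¬p))) other-end)
                        (trans (cong (k +_) (proj₂ (pendant-high ¬p))) label-value)
                        (ceil-gap2 (k + 2 * (2 + m)) (positive _))
    where
    other-end : k + (2 + m + suc (3 + m)) ≡ 2 + (k + 2 * (2 + m))
    other-end = solve (k ∷ m ∷ [])
    label-value : k + (2 + m + (3 + m)) ≡ 1 + (k + 2 * (2 + m))
    label-value = solve (k ∷ m ∷ [])

  rankOf : Fin n → ℕ
  rankOf i = rank (toℕ i)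

  rankOf-< : ∀ i → rankOf i < n
  rankOf-< i = rank-< (position (toℕ i) (toℕ<n i))

  rankOf-injective : ∀ {i j} → rankOf i ≡ rankOf j → i ≡ j
  rankOf-injective {i} {j} eq = toℕ-injective (rank-injective (position (toℕ i) (toℕ<n i))
    (subst (Position (toℕ j)) (sym eq) (position (toℕ j) (toℕ<n j))))

  rankOf-next : ∀ i → rankOf (next i) ≡ rank (succPos (toℕ i))
  rankOf-next i = cong rank (toℕ-fromℕ< (m%n<n (suc (toℕ i)) n))

  vertexValue : Fin n ⊎ Fin n → ℕ
  vertexValue (inj₁ i) = k + 2 * rankOf i
  vertexValue (inj₂ i) = k + pendantValue (rankOf i)

  edgeLabel : Fin n ⊎ Fin n → ℕ
  edgeLabel (inj₁ i) = k + zig (rankOf i + rankOf (next i))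
  edgeLabel (inj₂ i) = k + pendantLabel (rankOf i)

  ψ : Fin (n + n) → ℕ
  ψ v = vertexValue (splitAt n v)

  label : Fin (n + n) → ℕ
  label e = edgeLabel (splitAt n e)

  ψ-cycle : ∀ i → ψ (i ↑ˡ n) ≡ k + 2 * rankOf i
  ψ-cycle i = cong vertexValue (splitAt-↑ˡ n i n)

  ψ-pendant : ∀ i → ψ (n ↑ʳ i) ≡ k + pendantValue (rankOf i)
  ψ-pendant i = cong vertexValue (splitAt-↑ʳ n n i)

  vertexValue-injective : ∀ u v → vertexValue u ≡ vertexValue v → u ≡ v
  vertexValue-injective (inj₁ i) (inj₁ j) e =
    cong inj₁ (rankOf-injective (*-cancelˡ-≡ _ _ 2 (+-cancelˡ-≡ k _ _ e)))
  vertexValue-injective (inj₁ i) (inj₂ j) e =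
    ⊥-elim (cycle≢pendant {r' = rankOf j} (rankOf-< i) (+-cancelˡ-≡ k _ _ e))
  vertexValue-injective (inj₂ i) (inj₁ j) e =
    ⊥-elim (cycle≢pendant {r' = rankOf i} (rankOf-< j) (sym (+-cancelˡ-≡ k _ _ e)))
  vertexValue-injective (inj₂ i) (inj₂ j) e =
    cong inj₂ (rankOf-injective (pendant-injective {rankOf i} {rankOf j} (+-cancelˡ-≡ k _ _ e)))

  ψ-injective : Injective _≡_ _≡_ ψ
  ψ-injective {u} {v} e = begin
      u                      ≡⟨ sym (join-splitAt n n u) ⟩
      join n n (splitAt n u) ≡⟨ cong (join n n) (vertexValue-injective (splitAt n u) (splitAt n v) e) ⟩
      join n n (splitAt n v) ≡⟨ join-splitAt n n v ⟩
      v                      ∎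
    where open ≡-Reasoning

  vertexValue-range : ∀ u → k ≤ vertexValue u × vertexValue u ≤ k + (n + n)
  vertexValue-range (inj₁ i) = m≤m+n k _ , +-monoʳ-≤ k (cycle-value-≤ (rankOf-< i))
  vertexValue-range (inj₂ i) = m≤m+n k _ , +-monoʳ-≤ k (pendant-value-≤ (rankOf-< i))

  edgeLabel-range : ∀ e → k ≤ edgeLabel e × edgeLabel e < k + (n + n)
  edgeLabel-range (inj₁ i) = m≤m+n k _ , +-monoʳ-< k (cycle-label-< (rankOf-< i) (rankOf-< (next i)))
  edgeLabel-range (inj₂ i) = m≤m+n k _ , +-monoʳ-< k (pendant-label-< (rankOf-< i))

  ψ-range : ∀ v → k ≤ ψ v × ψ v ≤ k + (n + n)
  ψ-range v = vertexValue-range (splitAt n v)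

  label-range : ∀ e → k ≤ label e × label e < k + (n + n)
  label-range e = edgeLabel-range (splitAt n e)

  edge-gm : ∀ e → let (u , v) = edge (crown n) e in GMLabel (ψ u * ψ v) (label e)
  edge-gm e with splitAt n e
  ... | inj₁ i = subst₂ (λ x y → GMLabel (x * y) (edgeLabel (inj₁ i)))
                   (sym (ψ-cycle i)) (sym (ψ-cycle (next i)))
                   (adjacent-gm (subst (Adjacent (rankOf i)) (sym (rankOf-next i))
                                       (cycle-adjacent (toℕ i) (toℕ<n i))))
  ... | inj₂ i = subst₂ (λ x y → GMLabel (x * y) (edgeLabel (inj₂ i)))
                   (sym (ψ-cycle i)) (sym (ψ-pendant i))
                   (pendant-gm (rankOf-< i))

  realise : ∀ {d} → Source d → ∃ λ e → label e ≡ k + d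
  realise (zig-edge {a} {b} z refl) with zig-edge-on-cycle z
  ... | i , i<n , sum = j ↑ˡ n , (begin
      label (j ↑ˡ n)                        ≡⟨ cong edgeLabel (splitAt-↑ˡ n j n) ⟩
      k + zig (rankOf j + rankOf (next j))  ≡⟨ cong (λ s → k + zig s) (cong₂ _+_ rank-j rank-next-j) ⟩
      k + zig (rank i + rank (succPos i))   ≡⟨ cong (λ s → k + zig s) sum ⟩
      k + zig (a + b)                       ∎)
    where
    open ≡-Reasoning
    j : Fin n
    j = fromℕ< i<n
    rank-j : rankOf j ≡ rank i
    rank-j = cong rank (toℕ-fromℕ< i<n)
    rank-next-j : rankOf (next j) ≡ rank (succPos i)
    rank-next-j = trans (rankOf-next j) (cong (λ x → rank (succPos x)) (toℕ-fromℕ< i<n))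
  realise (pendant-edge {r} r<n refl) with position-of r r<n
  ... | i , pos = n ↑ʳ j , (begin
      label (n ↑ʳ j)              ≡⟨ cong edgeLabel (splitAt-↑ʳ n n j) ⟩
      k + pendantLabel (rankOf j) ≡⟨ cong (λ x → k + pendantLabel (rank x)) (toℕ-fromℕ< (position-< pos)) ⟩
      k + pendantLabel (rank i)   ≡⟨ cong (λ x → k + pendantLabel x) (rank-at pos) ⟩
      k + pendantLabel r          ∎)
    where
    open ≡-Reasoning
    j : Fin n
    j = fromℕ< (position-< pos)

  label-onto : ∀ l → k ≤ l → l < k + (n + n) → ∃ λ e → label e ≡ l
  label-onto l k≤l l<k+2n with difference k≤l
  ... | d , refl = realise (source d (+-cancelˡ-< k d (n + n) l<k+2n))

mainTheorem6 : (n k : ℕ) → 3 ≤ n → 1 ≤ k → IsKGeometricMean k (crown n)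
mainTheorem6 (suc (suc (suc m))) k (s≤s (s≤s (s≤s z≤n))) k≥1 =
  ψ , label , ψ-injective , ψ-range , edge-gm , label-range , label-onto
  where open CrownLabelling m k k≥1
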